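{- Let $\mathcal G$ be a finite call graph over a junction network $\mathcal J^\star(\mathcal A)$, let $P\in\mathcal G$ be a flow and let $\sigma$ be a parameter assignment. Then the trace $T(\mathcal G,P,\sigma)$ is a finite tree (its recursive computation terminates).
   Context: $\omega$-terms are built from $\bar 0$, $s$, parameters (variables of sort $\omega$) and primitive-recursively defined numeric function symbols; $\mathcal S$ is the set of all parameter assignments (maps from parameters to numerals), and $\sigma(t){\downarrow_\omega}$ is the numeral value of $t$ under $\sigma$ (applied componentwise to tuples). A point of length $m$ is an $m$-tuple of $\omega$-terms. For each $m$, $\prec_m$ is a well-founded total order on $m$-tuples of numerals; for $S\subseteq\mathcal S$ and points $\mathbf v,\mathbf v'$ of length $m$, $\mathbf v\prec^S_m\mathbf v'$ iff $\sigma(\mathbf v){\downarrow_\omega}\prec_m\sigma(\mathbf v'){\downarrow_\omega}$ for every $\sigma\in S$. $\Delta$ is a countably infinite set of symbols and $\mathcal A\colon\Delta\to\mathbb N$ an arity function; an $\mathcal A$-junction is a pair $(\delta,p)$ with $p$ a point of length $\mathcal A(\delta)$, and $\mathcal J^\star(\mathcal A)$ is the set of all $\mathcal A$-junctions. Network order: $(\delta,p)\prec^S(\delta',q)$ iff either $p\prec^S_{\mathcal A(\delta)}q$, or $\mathcal A(\delta')<\mathcal A(\delta)$. A flow is given by a partition $\mathcal S^*$ of $\mathcal S$ into mutually disjoint sets and an injective map $P$ from $\mathcal S^*$ to finite subsets of $\mathcal J^\star(\mathcal A)$ such that (1) there is a unique junction $[P]$, the source, with $[P]\in P(S)$ for all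 $S\in\mathcal S^*$, and (2) for all $S\in\mathcal S^*$ and $q\in P(S)$, $q\prec^S[P]$ or $q=[P]$. A call graph is a finite set $\mathcal G$ of flows such that for every $P_1\in\mathcal G$ (with partition $\mathcal S^*_1$), every $S\in\mathcal S^*_1$, every $\sigma\in S$ and every $j\in P_1(S)$ there exist a unique $P_2\in\mathcal G$ and a parameter assignment $\theta$ with $\theta([P_2]){\downarrow_\omega}=\sigma(j){\downarrow_\omega}$ (applied to the points, symbols equal); write $\mathrm{flow}(j,\sigma)=P_2$ and $\mathrm{subst}(j,\sigma)=\theta$. An $\mathcal A$-trace is a pair $[j,\mathcal T]$ of a junction $j$ and a set $\mathcal T$ of $\mathcal A$-traces. For $P\in\mathcal G$ with partition $\mathcal S^*$, $\sigma\in S\in\mathcal S^*$, the trace is defined recursively by $T(\mathcal G,P,\sigma)=\big[\sigma([P]){\downarrow_\omega},\ \bigcup_{j\in P(S)\setminus\{[P]\}}T(\mathcal G,\mathrm{flow}(j,\sigma),\mathrm{subst}(j,\sigma))\big]$. -}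

module Defs where

open import Data.Nat using (ℕ; zero; suc; _<_)
open import Data.Fin using (Fin)
open import Data.Vec using (Vec; []; _∷_; lookup)
open import Data.List using (List)
open import Data.List.Membership.Propositional using (_∈_)
open import Data.Product using (Σ; ∃; _×_; _,_)
open import Data.Sum using (_⊎_)
open import Relation.Binary.PropositionalEquality using (_≡_; subst)
open import Relation.Nullary using (¬_)

data PR : ℕ → Set where
  zeroF : ∀ {k} → PR k
  succF : PR 1
  proj  : ∀ {k} → Fin k → PR k
  comp  : ∀ {k m} → PR m → Vec (PR k) m → PR k
  prec  : ∀ {k} → PR k → PR (suc (suc k)) → PR (suc k)

mutual
  evalPR : ∀ {k} → PR k → Vec ℕ k → ℕ
  evalPR zeroF xs = 0
  evalPR succF (x ∷ []) = suc x
  evalPR (proj i) xs = lookup xs i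
  evalPR (comp f gs) xs = evalPR f (evalPRs gs xs)
  evalPR (prec f g) (zero ∷ xs) = evalPR f xs
  evalPR (prec f g) (suc n ∷ xs) = evalPR g (evalPR (prec f g) (n ∷ xs) ∷ n ∷ xs)

  evalPRs : ∀ {k m} → Vec (PR k) m → Vec ℕ k → Vec ℕ m
  evalPRs [] xs = []
  evalPRs (g ∷ gs) xs = evalPR g xs ∷ evalPRs gs xs

data Term : Set where
  zero̅ : Term
  s    : Term → Term
  par  : ℕ → Term
  app  : ∀ {k} → PR k → Vec Term k → Term

-- parameter assignments (numerals represented by ℕ)
Asg : Set
Asg = ℕ → ℕ

mutual
  ev : Asg → Term → ℕ
  ev σ zero̅ = 0
  ev σ (s t) = suc (ev σ t)
  ev σ (par x) = σ x
  ev σ (app f ts) = evalPR f (evs σ ts)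

  evs : ∀ {m} → Asg → Vec Term m → Vec ℕ m
  evs σ [] = []
  evs σ (t ∷ ts) = ev σ t ∷ evs σ ts

Orders : Set₁
Orders = (m : ℕ) → Vec ℕ m → Vec ℕ m → Set

-- Junctions over the symbol set Δ = ℕ with arity function A

Junction : (ℕ → ℕ) → Set
Junction A = Σ ℕ (λ δ → Vec Term (A δ))

evJ : ∀ {A : ℕ → ℕ} → Asg → Junction A → Σ ℕ (λ δ → Vec ℕ (A δ))
evJ σ (δ , p) = (δ , evs σ p)

SetAsg : Set₁
SetAsg = Asg → Set

PtLt : Orders → SetAsg → ∀ {m} → Vec Term m → Vec Term m → Set
PtLt ≺ S {m} v v' = ∀ σ → S σ → ≺ m (evs σ v) (evs σ v')

NetLt : (A : ℕ → ℕ) → Orders → SetAsg → Junction A → Junction A → Set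
NetLt A ≺ S (δ , p) (δ' , q) =
  (Σ (A δ ≡ A δ') (λ e → PtLt ≺ S (subst (Vec Term) e p) q)) ⊎ (A δ' < A δ)

-- The partition S* of 𝒮 is given by an index set Idx of blocks
-- and the map cls sending each assignment to its (unique) block; blocks
-- are nonempty (cls surjective), hence mutually disjoint and covering.

record Flow (A : ℕ → ℕ) (≺ : Orders) : Set₁ where
  field
    Idx      : Set
    cls      : Asg → Idx
    cls-surj : ∀ i → ∃ λ σ → cls σ ≡ i
    P        : Idx → List (Junction A)      -- finite subsets
    P-inj    : ∀ i i' → (∀ j → (j ∈ P i → j ∈ P i') × (j ∈ P i' → j ∈ P i)) → i ≡ i'
    src      : Junction A
    src∈     : ∀ i → src ∈ P i
    src-uniq : ∀ j → (∀ i → j ∈ P i) → j ≡ src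
    decr     : ∀ i q → q ∈ P i → NetLt A ≺ (λ σ → cls σ ≡ i) q src ⊎ q ≡ src

  Block : Idx → SetAsg
  Block i σ = cls σ ≡ i

-- Call graphs: a finite family of flows G 0 … G (n-1), together with the
-- (chosen) maps flow(j,σ) and subst(j,σ) witnessing the call-graph condition.

record CallGraph (A : ℕ → ℕ) (≺ : Orders) : Set₁ where
  field
    n       : ℕ
    G       : Fin n → Flow A ≺
  open Flow
  field
    flowOf  : ∀ k σ j → j ∈ P (G k) (cls (G k) σ) → Fin n
    substOf : ∀ k σ j → j ∈ P (G k) (cls (G k) σ) → Asg
    spec    : ∀ k σ j (m : j ∈ P (G k) (cls (G k) σ)) →
              evJ (substOf k σ j m) (src (G (flowOf k σ j m))) ≡ evJ σ j
    unique  : ∀ k σ j (m : j ∈ P (G k) (cls (G k) σ)) k' θ →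
              evJ θ (src (G k')) ≡ evJ σ j → G k' ≡ G (flowOf k σ j m)

  -- One recursive call in the computation of T(G, G k, σ):
  -- Step (k', θ) (k, σ) iff T(G, G k', θ) is one of the subtraces
  -- T(G, flow(j,σ), subst(j,σ)) for some j ∈ P(S) ∖ {[P]} with σ ∈ S.
  Step : (Fin n × Asg) → (Fin n × Asg) → Set
  Step (k' , θ) (k , σ) =
    Σ (Junction A) λ j → Σ (j ∈ P (G k) (cls (G k) σ)) λ m →
      (¬ (j ≡ src (G k))) × (k' ≡ flowOf k σ j m) × (θ ≡ substOf k σ j m)

module Submission where

-- Give each node (k, σ) the measure "value of the source of flow k
-- under σ", a pair (a, v) of an arity a and a numeral tuple v of length a.
-- By the flow condition every call j ∈ P(S) ∖ {[P]} lies strictly below the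
-- source in the network order, and by the call-graph condition the called
-- node's source evaluates to exactly σ(j).  Hence along each call either
-- the arity strictly grows, or it stays equal and the tuple strictly
-- decreases in ≺_a.  Since the finitely many flows have bounded source
-- arities, "arity grows" is well-founded, so the measure decreases in a
-- dependent lexicographic order, which is well-founded.

open import Defs
open import Data.Nat using (ℕ; zero; suc; _+_; _∸_; _≤_; _<_)
open import Data.Nat.Properties using (∸-monoʳ-<; m≤m+n; m≤n+m; ≤-trans)
open import Data.Nat.Induction using (<-wellFounded)
open import Data.Fin using (Fin)
import Data.Fin as Fin
open import Data.Vec using (Vec)
open import Data.Product using (Σ; ∃; _,_; proj₁; proj₂; _×_)
open import Data.Sum using (_⊎_; inj₁; inj₂)
open import Data.Empty using (⊥-elim)
open import Function using (_on_)
open import Relation.Binary.PropositionalEquality using (_≡_; refl; cong; sym; trans; subst)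
open import Relation.Binary.Structures using (IsStrictTotalOrder)
open import Relation.Binary.Construct.On as On using ()
open import Induction.WellFounded using (WellFounded; Acc; acc; module Subrelation)

finite-bounded : ∀ n (f : Fin n → ℕ) → Σ ℕ λ N → ∀ i → f i ≤ N
finite-bounded zero    f = 0 , λ ()
finite-bounded (suc n) f with finite-bounded n (λ i → f (Fin.suc i))
... | N , f≤N = f Fin.zero + N , λ where
  Fin.zero    → m≤m+n _ _
  (Fin.suc i) → ≤-trans (f≤N i) (m≤n+m _ _)

-- Stated with an equation of
-- pairs so that callers never have to transport along index equalities.
module _ {I : Set} {B : I → Set} (_<ᵢ_ : I → I → Set) (R : ∀ i → B i → B i → Set) where

  LexΣ : Σ I B → Σ I B → Set
  LexΣ (i′ , v′) (i , v) = i′ <ᵢ i ⊎ ∃ λ w → (i′ , v′) ≡ (i , w) × R i w v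

  lexΣ-acc : (∀ i → WellFounded (R i)) → ∀ {i} → Acc _<ᵢ_ i → ∀ v → Acc LexΣ (i , v)
  lexΣ-acc wfR {i} (acc rsI) v = fibre (wfR i v)
    where
    fibre : ∀ {v} → Acc (R i) v → Acc LexΣ (i , v)
    fibre {v} (acc rsV) = acc below
      where
      below : ∀ {y} → LexΣ y (i , v) → Acc LexΣ y
      below {i′ , v′} (inj₁ i′<i)    = lexΣ-acc wfR (rsI i′<i) v′
      below (inj₂ (w , refl , w<v)) = fibre (rsV w<v)

  lexΣ-wellFounded : WellFounded _<ᵢ_ → (∀ i → WellFounded (R i)) → WellFounded LexΣ
  lexΣ-wellFounded wfI wfR (i , v) = lexΣ-acc wfR (wfI i) v

evs-subst : ∀ σ {a b} (e : a ≡ b) (p : Vec Term a) →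
            _≡_ {A = Σ ℕ (Vec ℕ)} (a , evs σ p) (b , evs σ (subst (Vec Term) e p))
evs-subst σ refl p = refl

module Termination (A : ℕ → ℕ) (≺ : Orders) (≺-wf : ∀ m → WellFounded (≺ m))
                   (𝒢 : CallGraph A ≺) where
  open CallGraph 𝒢
  open Flow

  shape : Σ ℕ (λ δ → Vec ℕ (A δ)) → Σ ℕ (Vec ℕ)
  shape (δ , v) = A δ , v

  arity : Fin n → ℕ
  arity k = A (proj₁ (src (G k)))

  maxArity : ℕ
  maxArity = proj₁ (finite-bounded n arity)

  arity≤max : ∀ k → arity k ≤ maxArity
  arity≤max = proj₂ (finite-bounded n arity)

  measure : Fin n × Asg → Σ ℕ (Vec ℕ)
  measure (k , σ) = shape (evJ σ (src (G k)))

  -- Arities grow towards the bound maxArity; tuples of equal arity fall in ≺.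
  _⊏_ : Σ ℕ (Vec ℕ) → Σ ℕ (Vec ℕ) → Set
  _⊏_ = LexΣ (_<_ on (maxArity ∸_)) ≺

  ⊏-wellFounded : WellFounded _⊏_
  ⊏-wellFounded = lexΣ-wellFounded _ ≺ (On.wellFounded (maxArity ∸_) <-wellFounded) ≺-wf

  -- The called node's
  -- source has the value σ(j) (spec), and j lies below the source of flow k
  -- in the network order: either with larger arity, or with equal arity and
  -- a ≺-smaller value at σ itself (σ lies in its own block).
  call-decreases : ∀ {x y} → Step x y → measure x ⊏ measure y
  call-decreases {_} {k , σ} ((δ , p) , j∈P , j≢src , refl , refl)
    with decr (G k) (cls (G k) σ) (δ , p) j∈P
  ... | inj₂ j≡src = ⊥-elim (j≢src j≡src)
  ... | inj₁ (inj₂ src<j) = inj₁ (∸-monoʳ-< (subst (arity k <_) (sym same-arity) src<j) (arity≤max k′))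
    where
    k′ = flowOf k σ (δ , p) j∈P
    same-arity : arity k′ ≡ A δ
    same-arity = cong proj₁ (cong shape (spec k σ (δ , p) j∈P))
  ... | inj₁ (inj₁ (e , p<src)) =
    inj₂ (_ , trans (cong shape (spec k σ (δ , p) j∈P)) (evs-subst σ e p) , p<src σ refl)

  step-wellFounded : WellFounded Step
  step-wellFounded = Subrelation.wellFounded call-decreases (On.wellFounded measure ⊏-wellFounded)

theorem1 : (A : ℕ → ℕ) (≺ : Orders) →
    (∀ m → IsStrictTotalOrder _≡_ (≺ m)) →
    (∀ m → WellFounded (≺ m)) →
    (𝒢 : CallGraph A ≺) (k : Fin (CallGraph.n 𝒢)) (σ : Asg) →
    Acc (CallGraph.Step 𝒢) (k , σ)
theorem1 A ≺ _ ≺-wf 𝒢 k σ = Termination.step-wellFounded A ≺ ≺-wf 𝒢 (k , σ)
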